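{- Let $({\cal F},\tau)$ be an oriented Fano plane. If $\tau'\in\mathrm{Aut}({\cal F})$ is an automorphism of order seven which induces the same orientation as $\tau$ on every line $D$ of ${\cal F}$, then $\tau'\in\{\tau,\tau^2,\tau^4\}$.
   Context: ${\cal F}$ is a Fano plane (seven points, seven lines); $\mathrm{Aut}({\cal F})$ is the group of bijections sending lines to lines. An orientation is an element $\sigma\in\mathrm{Aut}({\cal F})$ of order seven. For such $\sigma$, exactly one of the following holds: (i) every line can be written uniquely as $\{P,\sigma(P),\sigma^3(P)\}$ for some point $P$; (ii) every line can be written uniquely as $\{P,\sigma^2(P),\sigma^3(P)\}$. The orientation induced by $\sigma$ on a line is the cyclic order $(P,\sigma(P),\sigma^3(P))$ in case (i) and $(P,\sigma^2(P),\sigma^3(P))$ in case (ii), with $P$ the unique point given there. -}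

module Defs where

open import Data.Nat using (ℕ; zero; suc; _≤_; _<_)
open import Data.Fin using (Fin)
open import Data.Bool using (Bool; true)
open import Data.Product using (Σ; ∃; _×_; _,_)
open import Data.Sum using (_⊎_)
open import Relation.Binary.PropositionalEquality using (_≡_; _≢_)
open import Relation.Nullary using (¬_)
open import Function.Bundles using (_⇔_)
open import Function.Definitions using (Injective)

Point : Set
Point = Fin 7

LineIx : Set
LineIx = Fin 7

record FanoPlane : Set where
  field
    on : Point → LineIx → Bool
    three : ∀ D → Σ Point λ a → Σ Point λ b → Σ Point λ c →
              a ≢ b × b ≢ c × a ≢ c ×
              (∀ x → (on x D ≡ true) ⇔ (x ≡ a ⊎ x ≡ b ⊎ x ≡ c))
    join : ∀ P Q → P ≢ Q → Σ LineIx λ D → on P D ≡ true × on Q D ≡ true ×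
              (∀ D' → on P D' ≡ true → on Q D' ≡ true → D' ≡ D)

module _ (F : FanoPlane) where
  open FanoPlane F

  LineIs : LineIx → Point → Point → Point → Set
  LineIs D a b c = ∀ x → (on x D ≡ true) ⇔ (x ≡ a ⊎ x ≡ b ⊎ x ≡ c)

  -- Automorphism: bijection of points sending lines to lines
  -- (injective on the finite set Fin 7, hence bijective).
  IsAut : (Point → Point) → Set
  IsAut σ = Injective _≡_ _≡_ σ ×
            (∀ D → Σ LineIx λ D' → ∀ x → (on x D ≡ true) ⇔ (on (σ x) D' ≡ true))

iter : (Point → Point) → ℕ → Point → Point
iter σ zero x = x
iter σ (suc n) x = σ (iter σ n x)

_≐_ : (Point → Point) → (Point → Point) → Set
f ≐ g = ∀ x → f x ≡ g x

HasOrder7 : (Point → Point) → Set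
HasOrder7 σ = (iter σ 7 ≐ (λ x → x)) ×
              (∀ k → 1 ≤ k → k < 7 → ¬ (iter σ k ≐ (λ x → x)))

module _ (F : FanoPlane) where
  open FanoPlane F

  IsOrientation : (Point → Point) → Set
  IsOrientation σ = IsAut F σ × HasOrder7 σ

  CaseI : (Point → Point) → Set
  CaseI σ = ∀ D → Σ Point λ P → LineIs F D P (σ P) (iter σ 3 P) ×
              (∀ Q → LineIs F D Q (σ Q) (iter σ 3 Q) → Q ≡ P)

  CaseII : (Point → Point) → Set
  CaseII σ = ∀ D → Σ Point λ P → LineIs F D P (iter σ 2 P) (iter σ 3 P) ×
              (∀ Q → LineIs F D Q (iter σ 2 Q) (iter σ 3 Q) → Q ≡ P)

  -- Triple (a , b , c) is (a representative of) the orientation induced by σ on D.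
  Induces : (Point → Point) → LineIx → Point × Point × Point → Set
  Induces σ D (a , b , c) =
      (CaseI σ × Σ Point λ P → LineIs F D P (σ P) (iter σ 3 P) ×
                 a ≡ P × b ≡ σ P × c ≡ iter σ 3 P)
    ⊎ (CaseII σ × Σ Point λ P → LineIs F D P (iter σ 2 P) (iter σ 3 P) ×
                 a ≡ P × b ≡ iter σ 2 P × c ≡ iter σ 3 P)

SameCyclic : Point × Point × Point → Point × Point × Point → Set
SameCyclic (a , b , c) t = t ≡ (a , b , c) ⊎ t ≡ (b , c , a) ⊎ t ≡ (c , a , b)

SameOrientation : FanoPlane → (Point → Point) → (Point → Point) → Set
SameOrientation F σ σ' = ∀ D t t' → Induces F σ D t → Induces F σ' D t' → SameCyclic t t'

module Submission where

-- Call y ahead of x (for σ) when y = σᵏ x with k ∈ {1, 2, 4}, the nonzero squares modulo 7. An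
-- automorphism σ of order seven acts simply transitively on the seven points, and one checks that it
-- falls into case (i) or (ii); in both cases the cyclic order (a, b, c) it induces on a line satisfies
-- "b ahead of a, c ahead of b, a ahead of c". Every point Q starts a line (Q, τ′ᵈ Q, τ′³ Q) for τ′, and
-- comparing with the orientation of τ on it gives that τ′ x and τ′² x are ahead of x for τ, for every x.
-- Writing τ′ x = τ^e(x) x, the exponents e(x) and e(τ′ x) are squares whose sum is again a square;
-- since a sum of two distinct nonzero squares modulo 7 is never a square, e(τ′ x) = e(x). So e is
-- constant on the single τ′-orbit, i.e. τ′ = τᵏ with k ∈ {1, 2, 4}.

open import Data.Bool using (true)
open import Data.Empty using (⊥-elim)
open import Data.Fin using (Fin; toℕ; punchOut)
open import Data.Fin.Patterns using (0F; 1F; 2F; 3F; 4F; 5F; 6F)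
open import Data.Fin.Properties using (all?; toℕ<n; toℕ-injective; any?; ¬∀⟶∃¬; injective⇒≤; punchOut-injective)
  renaming (_≟_ to _≟ᶠ_)
open import Data.Nat using (ℕ; _≟_; zero; suc; _+_; _*_; _%_; _/_; _<_; s≤s; z≤n; NonZero)
open import Data.Nat.DivMod using (m≡m%n+[m/n]*n; m<n⇒m%n≡m; m%n<n)
open import Data.Nat.Properties using (+-comm; <-cmp; <-trans; n<1+n; ≤-refl; 1+n≰n)
open import Data.Product using (Σ; ∃; _×_; _,_; proj₁; proj₂)
open import Data.Sum as Sum using (_⊎_; inj₁; inj₂)
open import Function using (_∘_)
open import Function.Definitions using (Injective)
open import Relation.Binary using (tri<; tri≈; tri>)
open import Relation.Binary.PropositionalEquality
open import Relation.Nullary using (Dec; yes; no; contradiction)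
open import Relation.Nullary.Decidable using (_⊎-dec_; _→-dec_; toWitness; from-no)
open import Function.Bundles using (_⇔_; Equivalence; mk⇔)

open import Defs

injective⇒surjective : ∀ {n} {f : Fin n → Fin n} → Injective _≡_ _≡_ f → ∀ y → ∃ λ x → f x ≡ y
injective⇒surjective {suc n} {f} f-inj y with any? (λ x → f x ≟ᶠ y)
... | yes hit = hit
... | no miss = contradiction (injective⇒≤ punchOut∘f-injective) 1+n≰n
  where
    punchOut∘f-injective : Injective _≡_ _≡_ (λ x → punchOut {i = y} {j = f x} (λ e → miss (x , sym e)))
    punchOut∘f-injective e = f-inj (punchOut-injective (λ e′ → miss (_ , sym e′)) (λ e′ → miss (_ , sym e′)) e)

module _ (σ : Point → Point) where

  iter-+ : ∀ m n x → iter σ (m + n) x ≡ iter σ m (iter σ n x)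
  iter-+ zero    n x = refl
  iter-+ (suc m) n x = cong σ (iter-+ m n x)

  iter-comm : ∀ m n x → iter σ m (iter σ n x) ≡ iter σ n (iter σ m x)
  iter-comm m n x = begin
    iter σ m (iter σ n x)  ≡⟨ iter-+ m n x ⟨
    iter σ (m + n) x       ≡⟨ cong (λ k → iter σ k x) (+-comm m n) ⟩
    iter σ (n + m) x       ≡⟨ iter-+ n m x ⟩
    iter σ n (iter σ m x)  ∎
    where open ≡-Reasoning

  iter-injective : Injective _≡_ _≡_ σ → ∀ n → Injective _≡_ _≡_ (iter σ n)
  iter-injective σ-inj zero    e = e
  iter-injective σ-inj (suc n) e = iter-injective σ-inj n (σ-inj e)

  iter-*-fixed : ∀ {k x} → iter σ k x ≡ x → ∀ q → iter σ (q * k) x ≡ x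
  iter-*-fixed         h zero    = refl
  iter-*-fixed {k} {x} h (suc q) = trans (iter-+ k (q * k) x) (trans (cong (iter σ k) (iter-*-fixed h q)) h)

  iter-%-period : ∀ p .{{_ : NonZero p}} → iter σ p ≐ (λ x → x) → ∀ n x → iter σ n x ≡ iter σ (n % p) x
  iter-%-period p period n x = begin
    iter σ n x                                ≡⟨ cong (λ k → iter σ k x) (m≡m%n+[m/n]*n n p) ⟩
    iter σ (n % p + (n / p) * p) x            ≡⟨ iter-+ (n % p) ((n / p) * p) x ⟩
    iter σ (n % p) (iter σ ((n / p) * p) x)   ≡⟨ cong (iter σ (n % p)) (iter-*-fixed (period x) (n / p)) ⟩
    iter σ (n % p) x                          ∎
    where open ≡-Reasoning

inverse-mod-7 : ∀ k → 0 < k → k < 7 → Σ ℕ λ k′ → Σ ℕ λ q → k′ * k ≡ 1 + q * 7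
inverse-mod-7 1 _ _ = 1 , 0 , refl
inverse-mod-7 2 _ _ = 4 , 1 , refl
inverse-mod-7 3 _ _ = 5 , 2 , refl
inverse-mod-7 4 _ _ = 2 , 1 , refl
inverse-mod-7 5 _ _ = 3 , 2 , refl
inverse-mod-7 6 _ _ = 6 , 5 , refl
inverse-mod-7 (suc (suc (suc (suc (suc (suc (suc _))))))) _ (s≤s (s≤s (s≤s (s≤s (s≤s (s≤s (s≤s ())))))))

_∈₇_ : ℕ → ℕ × ℕ × ℕ → Set
a ∈₇ (p , q , r) = a % 7 ≡ p % 7 ⊎ a % 7 ≡ q % 7 ⊎ a % 7 ≡ r % 7

_∈₇?_ : ∀ a t → Dec (a ∈₇ t)
a ∈₇? (p , q , r) = (a % 7 ≟ p % 7) ⊎-dec (a % 7 ≟ q % 7) ⊎-dec (a % 7 ≟ r % 7)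

NoNontrivialTranslate : ℕ → Set
NoNontrivialTranslate d = ∀ (i : Fin 7) →
  toℕ i ∈₇ (0 , d , 3) → (d + toℕ i) ∈₇ (0 , d , 3) → (3 + toℕ i) ∈₇ (0 , d , 3) → toℕ i ≡ 0

no-nontrivial-translate? : ∀ d → Dec (NoNontrivialTranslate d)
no-nontrivial-translate? d = all? λ i →
  (toℕ i ∈₇? (0 , d , 3)) →-dec ((d + toℕ i) ∈₇? (0 , d , 3)) →-dec ((3 + toℕ i) ∈₇? (0 , d , 3)) →-dec
  (toℕ i ≟ 0)

-- Lines are {P, σᵈ P, σ³ P} with d = 1 in case (i) and d = 2 in case (ii).
data CaseIndex : ℕ → Set where
  case-i  : CaseIndex 1
  case-ii : CaseIndex 2

no-nontrivial-translate : ∀ {d} → CaseIndex d → NoNontrivialTranslate d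
no-nontrivial-translate case-i  = toWitness {a? = no-nontrivial-translate? 1} _
no-nontrivial-translate case-ii = toWitness {a? = no-nontrivial-translate? 2} _

module OrderSeven {σ : Point → Point} (σ-inj : Injective _≡_ _≡_ σ) (σ-order : HasOrder7 σ) where

  σ⁷≐id : iter σ 7 ≐ (λ x → x)
  σ⁷≐id = proj₁ σ-order

  fixed-by-power⇒fixed : ∀ {k y} → 0 < k → k < 7 → iter σ k y ≡ y → σ y ≡ y
  fixed-by-power⇒fixed {k} {y} 0<k k<7 h with inverse-mod-7 k 0<k k<7
  ... | k′ , q , k′k≡1+7q = begin
    σ y                       ≡⟨ cong σ (iter-*-fixed σ (σ⁷≐id y) q) ⟨
    iter σ (1 + q * 7) y      ≡⟨ cong (λ n → iter σ n y) k′k≡1+7q ⟨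
    iter σ (k′ * k) y         ≡⟨ iter-*-fixed σ h k′ ⟩
    y                         ∎
    where open ≡-Reasoning

  orbit-distinct : ∀ {a b y} → σ y ≢ y → a < b → b < 7 → iter σ a y ≢ iter σ b y
  orbit-distinct {zero}  {suc b} moved 0<b b<7 e = moved (fixed-by-power⇒fixed 0<b b<7 (sym e))
  orbit-distinct {suc a} {suc b} moved (s≤s a<b) b<7 e =
    orbit-distinct moved a<b (<-trans (n<1+n b) b<7) (σ-inj e)

  orbit-injective : ∀ {a b y} → σ y ≢ y → a < 7 → b < 7 → iter σ a y ≡ iter σ b y → a ≡ b
  orbit-injective {a} {b} moved a<7 b<7 e with <-cmp a b
  ... | tri< a<b _ _ = ⊥-elim (orbit-distinct moved a<b b<7 e)
  ... | tri≈ _ a≡b _ = a≡b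
  ... | tri> _ _ b<a = ⊥-elim (orbit-distinct moved b<a a<7 (sym e))

  orbit-of-moved : ∀ {x} → σ x ≢ x → ∀ y → Σ (Fin 7) λ i → iter σ (toℕ i) x ≡ y
  orbit-of-moved moved = injective⇒surjective λ {i} {j} e →
    toℕ-injective (orbit-injective moved (toℕ<n i) (toℕ<n j) e)

  moved-point : Σ Point λ x₀ → σ x₀ ≢ x₀
  moved-point = ¬∀⟶∃¬ 7 _ (λ x → σ x ≟ᶠ x) (proj₂ σ-order 1 ≤-refl (s≤s (s≤s z≤n)))

  no-fixed-point : ∀ y → σ y ≢ y
  no-fixed-point y σy≡y with moved-point
  ... | x₀ , x₀-moved with orbit-of-moved x₀-moved y
  ... | i , refl = x₀-moved (iter-injective σ σ-inj (toℕ i) (begin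
    iter σ (toℕ i) (σ x₀)  ≡⟨ iter-comm σ (toℕ i) 1 x₀ ⟩
    σ (iter σ (toℕ i) x₀)  ≡⟨ σy≡y ⟩
    iter σ (toℕ i) x₀      ∎))
    where open ≡-Reasoning

  orbit : ∀ x y → Σ (Fin 7) λ i → iter σ (toℕ i) x ≡ y
  orbit x = orbit-of-moved (no-fixed-point x)

  iter-≡⇒%-≡ : ∀ {m n} x → iter σ m x ≡ iter σ n x → m % 7 ≡ n % 7
  iter-≡⇒%-≡ {m} {n} x e = orbit-injective (no-fixed-point x) (m%n<n m 7) (m%n<n n 7) (begin
    iter σ (m % 7) x  ≡⟨ iter-%-period σ 7 σ⁷≐id m x ⟨
    iter σ m x        ≡⟨ e ⟩
    iter σ n x        ≡⟨ iter-%-period σ 7 σ⁷≐id n x ⟩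
    iter σ (n % 7) x  ∎)
    where open ≡-Reasoning

  %-≡⇒iter-≡ : ∀ {m n} x → m % 7 ≡ n % 7 → iter σ m x ≡ iter σ n x
  %-≡⇒iter-≡ {m} {n} x e = begin
    iter σ m x        ≡⟨ iter-%-period σ 7 σ⁷≐id m x ⟩
    iter σ (m % 7) x  ≡⟨ cong (λ k → iter σ k x) e ⟩
    iter σ (n % 7) x  ≡⟨ iter-%-period σ 7 σ⁷≐id n x ⟨
    iter σ n x        ∎
    where open ≡-Reasoning

  orbit-invariant⇒constant : ∀ {A : Set} (g : Point → A) → (∀ x → g (σ x) ≡ g x) → ∀ x y → g y ≡ g x
  orbit-invariant⇒constant g invariant x y with orbit x y
  ... | i , refl = along (toℕ i)
    where
      along : ∀ n → g (iter σ n x) ≡ g x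
      along zero    = refl
      along (suc n) = trans (invariant (iter σ n x)) (along n)

data QuadraticResidue₇ : ℕ → Set where
  one  : QuadraticResidue₇ 1
  two  : QuadraticResidue₇ 2
  four : QuadraticResidue₇ 4

residue<7 : ∀ {a} → QuadraticResidue₇ a → a < 7
residue<7 one  = s≤s (s≤s z≤n)
residue<7 two  = s≤s (s≤s (s≤s z≤n))
residue<7 four = s≤s (s≤s (s≤s (s≤s (s≤s z≤n))))

residue-sum-residue⇒equal : ∀ {a b} → QuadraticResidue₇ a → QuadraticResidue₇ b →
                            QuadraticResidue₇ ((a + b) % 7) → a ≡ b
residue-sum-residue⇒equal one  one  _  = refl
residue-sum-residue⇒equal two  two  _  = refl
residue-sum-residue⇒equal four four _  = refl
residue-sum-residue⇒equal one  two  ()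
residue-sum-residue⇒equal one  four ()
residue-sum-residue⇒equal two  one  ()
residue-sum-residue⇒equal two  four ()
residue-sum-residue⇒equal four one  ()
residue-sum-residue⇒equal four two  ()

Ahead : (Point → Point) → Point → Point → Set
Ahead σ x y = Σ ℕ λ k → QuadraticResidue₇ k × iter σ k x ≡ y

Oriented : (Point → Point) → Point × Point × Point → Set
Oriented σ (a , b , c) = Ahead σ a b × Ahead σ b c × Ahead σ c a

rotation-oriented : ∀ {σ t t′} → SameCyclic t t′ → Oriented σ t → Oriented σ t′
rotation-oriented (inj₁ refl)        o                  = o
rotation-oriented (inj₂ (inj₁ refl)) (ab , bc , ca)     = bc , ca , ab
rotation-oriented (inj₂ (inj₂ refl)) (ab , bc , ca)     = ca , ab , bc

module _ {σ : Point → Point} (σ-inj : Injective _≡_ _≡_ σ) (σ-order : HasOrder7 σ) where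
  open OrderSeven σ-inj σ-order

  ahead-twice⇒equal-steps : ∀ {u v w} (uv : Ahead σ u v) (vw : Ahead σ v w) → Ahead σ u w → proj₁ uv ≡ proj₁ vw
  ahead-twice⇒equal-steps {u} (a , Ra , refl) (b , Rb , refl) (c , Rc , u→w) =
    residue-sum-residue⇒equal Ra Rb (subst QuadraticResidue₇ c≡[a+b]%7 Rc)
    where
      open ≡-Reasoning
      c≡[a+b]%7 : c ≡ (a + b) % 7
      c≡[a+b]%7 = begin
        c             ≡⟨ m<n⇒m%n≡m (residue<7 Rc) ⟨
        c % 7         ≡⟨ iter-≡⇒%-≡ {c} {b + a} u (trans u→w (sym (iter-+ σ b a u))) ⟩
        (b + a) % 7   ≡⟨ cong (_% 7) (+-comm b a) ⟩
        (a + b) % 7   ∎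

module _ {τ ρ : Point → Point}
         (τ-inj : Injective _≡_ _≡_ τ) (τ-order : HasOrder7 τ)
         (ρ-inj : Injective _≡_ _≡_ ρ) (ρ-order : HasOrder7 ρ) where

  steps-ahead⇒power : (∀ x → Ahead τ x (ρ x)) → (∀ x → Ahead τ x (iter ρ 2 x)) →
                      Σ ℕ λ k → QuadraticResidue₇ k × ρ ≐ iter τ k
  steps-ahead⇒power step double-step = k , proj₁ (proj₂ (step 0F)) , ρ≐τᵏ
    where
      e : Point → ℕ
      e x = proj₁ (step x)

      e-invariant : ∀ x → e (ρ x) ≡ e x
      e-invariant x = sym (ahead-twice⇒equal-steps τ-inj τ-order (step x) (step (ρ x)) (double-step x))

      k : ℕ
      k = e 0F

      e-constant : ∀ x → e x ≡ k
      e-constant = OrderSeven.orbit-invariant⇒constant ρ-inj ρ-order e e-invariant 0F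

      ρ≐τᵏ : ρ ≐ iter τ k
      ρ≐τᵏ x = begin
        ρ x             ≡⟨ proj₂ (proj₂ (step x)) ⟨
        iter τ (e x) x  ≡⟨ cong (λ n → iter τ n x) (e-constant x) ⟩
        iter τ k x      ∎
        where open ≡-Reasoning

module FanoGeometry (F : FanoPlane) where
  open FanoPlane F

  on-line⇒listed : ∀ {D a b c x} → LineIs F D a b c → on x D ≡ true → x ≡ a ⊎ x ≡ b ⊎ x ≡ c
  on-line⇒listed L = Equivalence.to (L _)

  listed⇒on-line : ∀ {D a b c x} → LineIs F D a b c → x ≡ a ⊎ x ≡ b ⊎ x ≡ c → on x D ≡ true
  listed⇒on-line L = Equivalence.from (L _)

  rotate-line : ∀ {D a b c} → LineIs F D a b c → LineIs F D b c a
  rotate-line L x = mk⇔ (Sum.assocʳ ∘ Sum.swap ∘ on-line⇒listed L) (listed⇒on-line L ∘ Sum.swap ∘ Sum.assocˡ)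

  swap-line : ∀ {D a b c} → LineIs F D a b c → LineIs F D b a c
  swap-line L x = mk⇔ (swap₁₂ ∘ on-line⇒listed L) (listed⇒on-line L ∘ swap₁₂)
    where
      swap₁₂ : ∀ {A B C : Set} → A ⊎ B ⊎ C → B ⊎ A ⊎ C
      swap₁₂ = Sum.assocʳ ∘ Sum.map₁ Sum.swap ∘ Sum.assocˡ

  lines-meeting-twice-equal : ∀ {D₁ D₂ u v} → u ≢ v →
    on u D₁ ≡ true → on v D₁ ≡ true → on u D₂ ≡ true → on v D₂ ≡ true → D₁ ≡ D₂
  lines-meeting-twice-equal {D₁} {D₂} {u} {v} u≢v u∈D₁ v∈D₁ u∈D₂ v∈D₂ with join u v u≢v
  ... | _ , _ , _ , unique = trans (unique D₁ u∈D₁ v∈D₁) (sym (unique D₂ u∈D₂ v∈D₂))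

  third-point : ∀ {D u v} → u ≢ v → on u D ≡ true → on v D ≡ true →
                Σ Point λ w → LineIs F D u v w × w ≢ u × w ≢ v
  third-point {D} u≢v u∈D v∈D with three D
  ... | a , b , c , a≢b , b≢c , a≢c , L with on-line⇒listed L u∈D | on-line⇒listed L v∈D
  ... | inj₁ refl        | inj₁ refl        = ⊥-elim (u≢v refl)
  ... | inj₁ refl        | inj₂ (inj₁ refl) = c , L , ≢-sym a≢c , ≢-sym b≢c
  ... | inj₁ refl        | inj₂ (inj₂ refl) = b , swap-line (rotate-line (rotate-line L)) , ≢-sym a≢b , b≢c
  ... | inj₂ (inj₁ refl) | inj₁ refl        = c , swap-line L , ≢-sym b≢c , ≢-sym a≢c
  ... | inj₂ (inj₁ refl) | inj₂ (inj₁ refl) = ⊥-elim (u≢v refl)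
  ... | inj₂ (inj₁ refl) | inj₂ (inj₂ refl) = a , rotate-line L , a≢b , a≢c
  ... | inj₂ (inj₂ refl) | inj₁ refl        = b , rotate-line (rotate-line L) , b≢c , ≢-sym a≢b
  ... | inj₂ (inj₂ refl) | inj₂ (inj₁ refl) = a , swap-line (rotate-line L) , a≢c , a≢b
  ... | inj₂ (inj₂ refl) | inj₂ (inj₂ refl) = ⊥-elim (u≢v refl)

  relabel-line : ∀ {D a b c a′ b′ c′} → a ≡ a′ → b ≡ b′ → c ≡ c′ → LineIs F D a b c → LineIs F D a′ b′ c′
  relabel-line refl refl refl L = L

  image-line : ∀ {σ D a b c} → IsAut F σ → LineIs F D a b c → Σ LineIx λ D′ → LineIs F D′ (σ a) (σ b) (σ c)
  image-line {σ} {D} {a} {b} {c} (σ-inj , σ-lines) L with σ-lines D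
  ... | D′ , preserved = D′ , λ z → mk⇔ (to z) (from z)
    where
      to : ∀ z → on z D′ ≡ true → z ≡ σ a ⊎ z ≡ σ b ⊎ z ≡ σ c
      to z z∈D′ with injective⇒surjective σ-inj z
      ... | y , refl = Sum.map (cong σ) (Sum.map (cong σ) (cong σ))
                         (on-line⇒listed L (Equivalence.from (preserved y) z∈D′))
      from : ∀ z → z ≡ σ a ⊎ z ≡ σ b ⊎ z ≡ σ c → on z D′ ≡ true
      from _ (inj₁ refl)        = Equivalence.to (preserved a) (listed⇒on-line L (inj₁ refl))
      from _ (inj₂ (inj₁ refl)) = Equivalence.to (preserved b) (listed⇒on-line L (inj₂ (inj₁ refl)))
      from _ (inj₂ (inj₂ refl)) = Equivalence.to (preserved c) (listed⇒on-line L (inj₂ (inj₂ refl)))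

  image-line-iter : ∀ {σ D a b c} → IsAut F σ → ∀ n → LineIs F D a b c →
                    Σ LineIx λ D′ → LineIs F D′ (iter σ n a) (iter σ n b) (iter σ n c)
  image-line-iter σ-aut zero    L = _ , L
  image-line-iter σ-aut (suc n) L = image-line σ-aut (proj₂ (image-line-iter σ-aut n L))

  Starts : ℕ → (Point → Point) → Set
  Starts d σ = ∀ Q → Σ LineIx λ D → LineIs F D Q (iter σ d Q) (iter σ 3 Q)

  -- Case 1 σ is CaseI F σ and Case 2 σ is CaseII F σ.
  Case : ℕ → (Point → Point) → Set
  Case d σ = ∀ D → Σ Point λ P → LineIs F D P (iter σ d P) (iter σ 3 P) ×
               (∀ Q → LineIs F D Q (iter σ d Q) (iter σ 3 Q) → Q ≡ P)

  induces : ∀ {d σ D P} → CaseIndex d → Case d σ → LineIs F D P (iter σ d P) (iter σ 3 P) →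
            Induces F σ D (P , iter σ d P , iter σ 3 P)
  induces case-i  case L = inj₁ (case , _ , L , refl , refl , refl)
  induces case-ii case L = inj₂ (case , _ , L , refl , refl , refl)

  induced-oriented : ∀ {σ D} → iter σ 7 ≐ (λ x → x) → ∀ t → Induces F σ D t → Oriented σ t
  induced-oriented {σ} period _ (inj₁ (_ , P , _ , refl , refl , refl)) =
    (1 , one , refl) , (2 , two , refl) , (4 , four , wrap-around P)
    where wrap-around : ∀ P → iter σ 4 (iter σ 3 P) ≡ P
          wrap-around P = trans (sym (iter-+ σ 4 3 P)) (period P)
  induced-oriented {σ} period _ (inj₂ (_ , P , _ , refl , refl , refl)) =
    (2 , two , refl) , (1 , one , refl) , (4 , four , trans (sym (iter-+ σ 4 3 P)) (period P))

module Orientation (F : FanoPlane) {σ : Point → Point} (σ-aut : IsAut F σ) (σ-order : HasOrder7 σ) where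
  open FanoPlane F
  open FanoGeometry F
  open OrderSeven (proj₁ σ-aut) σ-order

  on-orbit-line : ∀ {D} x p q r → LineIs F D (iter σ p x) (iter σ q x) (iter σ r x) →
                  ∀ a → on (iter σ a x) D ≡ true ⇔ a ∈₇ (p , q , r)
  on-orbit-line x p q r L a = mk⇔
    (Sum.map (iter-≡⇒%-≡ {a} {p} x) (Sum.map (iter-≡⇒%-≡ {a} {q} x) (iter-≡⇒%-≡ {a} {r} x)) ∘ on-line⇒listed L)
    (listed⇒on-line L ∘ Sum.map (%-≡⇒iter-≡ {a} {p} x) (Sum.map (%-≡⇒iter-≡ {a} {q} x) (%-≡⇒iter-≡ {a} {r} x)))

  translate-orbit-line : ∀ {D} x p q r n → LineIs F D (iter σ p x) (iter σ q x) (iter σ r x) →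
                         Σ LineIx λ D′ → LineIs F D′ (iter σ (n + p) x) (iter σ (n + q) x) (iter σ (n + r) x)
  translate-orbit-line x p q r n L with image-line-iter σ-aut n L
  ... | D′ , L′ rewrite sym (iter-+ σ n p x) | sym (iter-+ σ n q x) | sym (iter-+ σ n r x) = D′ , L′

  translate-meeting-twice : ∀ {D} x p q r n → LineIs F D (iter σ p x) (iter σ q x) (iter σ r x) →
    ∀ a b → a % 7 ≢ b % 7 → a ∈₇ (p , q , r) → b ∈₇ (p , q , r) →
    a ∈₇ (n + p , n + q , n + r) → b ∈₇ (n + p , n + q , n + r) →
    ∀ c → c ∈₇ (n + p , n + q , n + r) → c ∈₇ (p , q , r)
  translate-meeting-twice {D} x p q r n L a b a≢b a∈L b∈L a∈L′ b∈L′ c c∈L′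
    with translate-orbit-line x p q r n L
  ... | D′ , L′ = Equivalence.to (on-L c)
                    (subst (λ D → on (iter σ c x) D ≡ true) (sym D≡D′) (Equivalence.from (on-L′ c) c∈L′))
    where
      on-L  = on-orbit-line x p q r L
      on-L′ = on-orbit-line x (n + p) (n + q) (n + r) L′
      D≡D′ = lines-meeting-twice-equal (a≢b ∘ iter-≡⇒%-≡ {a} {b} x)
               (Equivalence.from (on-L a) a∈L) (Equivalence.from (on-L b) b∈L)
               (Equivalence.from (on-L′ a) a∈L′) (Equivalence.from (on-L′ b) b∈L′)

  -- The third point σʲ x₀ of the line through x₀ and σ x₀ has j = 3 (case (i)) or j = 5 (case (ii),
  -- starting at σ⁵ x₀): for j = 2, 4, 6 the line would meet its translate by σ, σ³ resp. σ⁶ in two points.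
  base-line : Point → Σ ℕ λ d → CaseIndex d × Σ Point λ P → Σ LineIx λ D → LineIs F D P (iter σ d P) (iter σ 3 P)
  base-line x₀ with join x₀ (σ x₀) (≢-sym (no-fixed-point x₀))
  ... | D₀ , x₀∈D₀ , σx₀∈D₀ , _ with third-point (≢-sym (no-fixed-point x₀)) x₀∈D₀ σx₀∈D₀
  ... | w , L , w≢x₀ , w≢σx₀ with orbit x₀ w
  ... | 0F , refl = ⊥-elim (w≢x₀ refl)
  ... | 1F , refl = ⊥-elim (w≢σx₀ refl)
  ... | 2F , refl = ⊥-elim (from-no (3 ∈₇? (0 , 1 , 2))
         (translate-meeting-twice x₀ 0 1 2 1 L 1 2 (λ ()) (inj₂ (inj₁ refl)) (inj₂ (inj₂ refl))
                                  (inj₁ refl) (inj₂ (inj₁ refl)) 3 (inj₂ (inj₂ refl))))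
  ... | 3F , refl = 1 , case-i , x₀ , D₀ , L
  ... | 4F , refl = ⊥-elim (from-no (3 ∈₇? (0 , 1 , 4))
         (translate-meeting-twice x₀ 0 1 4 3 L 4 7 (λ ()) (inj₂ (inj₂ refl)) (inj₁ refl)
                                  (inj₂ (inj₁ refl)) (inj₂ (inj₂ refl)) 3 (inj₁ refl)))
  ... | 5F , refl = 2 , case-ii , iter σ 5 x₀ , D₀ ,
         relabel-line refl (sym σ⁷x₀≡x₀) (cong σ (sym σ⁷x₀≡x₀)) (rotate-line (rotate-line L))
    where σ⁷x₀≡x₀ = trans (sym (iter-+ σ 2 5 x₀)) (σ⁷≐id x₀)
  ... | 6F , refl = ⊥-elim (from-no (5 ∈₇? (0 , 1 , 6))
         (translate-meeting-twice x₀ 0 1 6 6 L 6 7 (λ ()) (inj₂ (inj₂ refl)) (inj₁ refl)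
                                  (inj₁ refl) (inj₂ (inj₁ refl)) 12 (inj₂ (inj₂ refl))))

  start-unique : ∀ {d D P Q} → CaseIndex d → LineIs F D P (iter σ d P) (iter σ 3 P) →
                 LineIs F D Q (iter σ d Q) (iter σ 3 Q) → Q ≡ P
  start-unique {d} {D} {P} {Q} cd LP LQ with orbit P Q
  ... | i , refl = cong (λ n → iter σ n P)
      (no-nontrivial-translate cd i (exponent 0 (listed⇒on-line LQ (inj₁ refl)))
                                    (exponent d (listed⇒on-line LQ (inj₂ (inj₁ refl))))
                                    (exponent 3 (listed⇒on-line LQ (inj₂ (inj₂ refl)))))
    where
      exponent : ∀ m → on (iter σ m (iter σ (toℕ i) P)) D ≡ true → (m + toℕ i) ∈₇ (0 , d , 3)
      exponent m = Equivalence.to (on-orbit-line P 0 d 3 LP (m + toℕ i))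
                 ∘ subst (λ y → on y D ≡ true) (sym (iter-+ σ m (toℕ i) P))

  starts : ∀ {d P₀ D₀} → LineIs F D₀ P₀ (iter σ d P₀) (iter σ 3 P₀) → Starts d σ
  starts {d} {P₀} L₀ Q with orbit P₀ Q
  ... | i , refl with image-line-iter σ-aut (toℕ i) L₀
  ... | D , L = D , relabel-line refl (iter-comm σ (toℕ i) d P₀) (iter-comm σ (toℕ i) 3 P₀) L

  start-line-injective : ∀ {d} → CaseIndex d → (start : Starts d σ) → Injective _≡_ _≡_ (proj₁ ∘ start)
  start-line-injective {d} cd start {Q} {R} e = sym (start-unique cd (proj₂ (start Q))
    (subst (λ D → LineIs F D R (iter σ d R) (iter σ 3 R)) (sym e) (proj₂ (start R))))

  starts⇒case : ∀ {d} → CaseIndex d → Starts d σ → Case d σ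
  starts⇒case cd start D with injective⇒surjective (start-line-injective cd start) D
  ... | P , refl = P , proj₂ (start P) , λ Q LQ → start-unique cd (proj₂ (start P)) LQ

  -- Abstract, since unfolding the case analysis of base-line makes type checking of clients explode.
  abstract
    orientation-case : Σ ℕ λ d → CaseIndex d × Starts d σ × Case d σ
    orientation-case =
      let d , cd , _ , _ , L₀ = base-line 0F in d , cd , starts {d} L₀ , starts⇒case cd (starts {d} L₀)

module _ {τ τ′ : Point → Point} (τ′-order : HasOrder7 τ′) where

  oriented-starts⇒steps-ahead : ∀ {d} → CaseIndex d → (∀ Q → Oriented τ (Q , iter τ′ d Q , iter τ′ 3 Q)) →
                                (∀ x → Ahead τ x (τ′ x)) × (∀ x → Ahead τ x (iter τ′ 2 x))
  oriented-starts⇒steps-ahead case-i oriented =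
      (λ x → proj₁ (oriented x))
    , (λ x → subst (λ y → Ahead τ y (iter τ′ 2 y)) (proj₁ τ′-order x) (proj₁ (proj₂ (oriented (iter τ′ 6 x)))))
  oriented-starts⇒steps-ahead case-ii oriented =
      (λ x → subst (λ y → Ahead τ y (τ′ y)) (τ′²τ′⁵≐id x) (proj₁ (proj₂ (oriented (iter τ′ 5 x)))))
    , (λ x → proj₁ (oriented x))
    where
      τ′²τ′⁵≐id : ∀ x → iter τ′ 2 (iter τ′ 5 x) ≡ x
      τ′²τ′⁵≐id x = trans (sym (iter-+ τ′ 2 5 x)) (proj₁ τ′-order x)

module _ (F : FanoPlane) {τ τ′ : Point → Point} where
  open FanoGeometry F

  same-orientation⇒starts-oriented : ∀ {d d′} → iter τ 7 ≐ (λ x → x) → SameOrientation F τ τ′ →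
    CaseIndex d → Case d τ → CaseIndex d′ → Starts d′ τ′ → Case d′ τ′ →
    ∀ Q → Oriented τ (Q , iter τ′ d′ Q , iter τ′ 3 Q)
  same-orientation⇒starts-oriented period same cd τ-case cd′ τ′-starts τ′-case Q with τ′-starts Q
  ... | D , LQ with τ-case D
  ... | P , LP , _ = rotation-oriented (same D _ _ τ-induced (induces cd′ τ′-case LQ))
                                       (induced-oriented period _ τ-induced)
    where τ-induced = induces cd τ-case LP

proposition2p36 : (F : FanoPlane) (τ τ' : Point → Point) →
    IsOrientation F τ → IsAut F τ' → HasOrder7 τ' → SameOrientation F τ τ' →
    (τ' ≐ τ) ⊎ (τ' ≐ iter τ 2) ⊎ (τ' ≐ iter τ 4)
proposition2p36 F τ τ′ (τ-aut , τ-order) τ′-aut τ′-order same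
  with Orientation.orientation-case F τ-aut τ-order | Orientation.orientation-case F τ′-aut τ′-order
... | _ , cd , _ , τ-case | _ , cd′ , τ′-starts , τ′-case
  with oriented-starts⇒steps-ahead τ′-order cd′
         (same-orientation⇒starts-oriented F (proj₁ τ-order) same cd τ-case cd′ τ′-starts τ′-case)
... | steps , double-steps
  with steps-ahead⇒power (proj₁ τ-aut) τ-order (proj₁ τ′-aut) τ′-order steps double-steps
... | _ , one  , τ′≐τ  = inj₁ τ′≐τ
... | _ , two  , τ′≐τ² = inj₂ (inj₁ τ′≐τ²)
... | _ , four , τ′≐τ⁴ = inj₂ (inj₂ τ′≐τ⁴)
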